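{- Let $\mathrm{SEP}(K_n)=\operatorname{conv}\{\mathbf{e}_i-\mathbf{e}_j\in\mathbb{R}^n:i\neq j\}$, and label its facets by nonempty proper subsets of $[n]$, the facet labeled $S$ being $\mathrm{SEP}(K_n)\cap\{\mathbf{x}:\mathbf{e}_S^\top\mathbf{x}=1\}$. Two facets of $\mathrm{SEP}(K_n)$ are adjacent if and only if their labels differ in exactly one element (i.e. their symmetric difference has exactly one element).
   Context: $\mathrm{SEP}(K_n)$ is an $(n-1)$-dimensional polytope lying in the hyperplane $\{\mathbf{x}:\mathbf{1}^\top\mathbf{x}=0\}$, with exactly $2^n-2$ facets, one for each nonempty proper subset $S\subset[n]$, namely the facet contained in the hyperplane $\{\mathbf{x}:\mathbf{e}_S^\top\mathbf{x}=1\}$, where $\mathbf{e}_S=\sum_{i\in S}\mathbf{e}_i$ and $\mathbf{1}=\mathbf{e}_{[n]}$. Two facets of a $d$-dimensional polytope are adjacent if their intersection is a nonempty face of dimension $d-2$.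
   Formalization: The points of SEP(K_n), of its facets and of their intersections, including those counted for dimension, have coordinates in ℚ^n rather than ℝ^n, with rational convex weights. -}

module Defs where

open import Data.Nat using (ℕ; zero; suc; _∸_; _≤_)
open import Data.Fin using (Fin; zero; suc)
open import Data.Fin.Subset using (Subset; _∈_; _─_; _∪_; ∣_∣; Nonempty; ∁; inside; outside)
open import Data.Vec using (lookup)
open import Data.Rational using (ℚ; 0ℚ; 1ℚ; _+_; _*_; _-_) renaming (_≤_ to _≤ℚ_)
open import Data.Product using (Σ; ∃; _×_)
open import Relation.Binary.PropositionalEquality using (_≡_; _≢_)

Point : ℕ → Set
Point n = Fin n → ℚ

sumℚ : ∀ {n} → (Fin n → ℚ) → ℚ
sumℚ {zero} f = 0ℚ
sumℚ {suc n} f = f zero + sumℚ (λ i → f (suc i))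

e : ∀ {n} → Fin n → Point n
e {suc n} zero zero = 1ℚ
e {suc n} zero (suc k) = 0ℚ
e {suc n} (suc i) zero = 0ℚ
e {suc n} (suc i) (suc k) = e i k

indicator : ∀ {n} → Subset n → Fin n → ℚ
indicator S i with lookup S i
... | inside = 1ℚ
... | outside = 0ℚ

dotS : ∀ {n} → Subset n → Point n → ℚ
dotS S x = sumℚ (λ i → indicator S i * x i)

-- SEP(K_n) = conv { e_i - e_j : i ≠ j }, as a set of points of ℚ^n:
-- x is a convex combination with weights λ i j ≥ 0 (λ i i = 0), summing to 1.
InSEP : (n : ℕ) → Point n → Set
InSEP n x = Σ (Fin n → Fin n → ℚ) λ w →
    (∀ i j → 0ℚ ≤ℚ w i j)
  × (∀ i → w i i ≡ 0ℚ)
  × (sumℚ (λ i → sumℚ (λ j → w i j)) ≡ 1ℚ)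
  × (∀ k → x k ≡ sumℚ (λ i → sumℚ (λ j → w i j * (e i k - e j k))))

Facet : (n : ℕ) → Subset n → Point n → Set
Facet n S x = InSEP n x × (dotS S x ≡ 1ℚ)

IsLabel : ∀ {n} → Subset n → Set
IsLabel S = Nonempty S × Nonempty (∁ S)

AffinelyIndependent : ∀ {n k} → (Fin k → Point n) → Set
AffinelyIndependent {n} {k} p =
  (c : Fin k → ℚ) → sumℚ c ≡ 0ℚ →
  (∀ t → sumℚ (λ m → c m * p m t) ≡ 0ℚ) → ∀ m → c m ≡ 0ℚ

HasAffIndep : ∀ {n} → (Point n → Set) → ℕ → Set
HasAffIndep {n} F k = Σ (Fin k → Point n) λ p → (∀ m → F (p m)) × AffinelyIndependent p

-- dim F = d  (for nonempty F) expressed as: the maximal number of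
-- affinely independent points of F is d + 1.
MaxAffIndep : ∀ {n} → (Point n → Set) → ℕ → Set
MaxAffIndep F k = HasAffIndep F k × (∀ m → HasAffIndep F m → m ≤ k)

-- Adjacency of facets of the (n-1)-dimensional polytope SEP(K_n):
-- their intersection is nonempty and of dimension (n-1)-2 = n-3,
-- i.e. its affine hull is spanned by exactly n-2 affinely independent points.
Adjacent : (n : ℕ) → Subset n → Subset n → Set
Adjacent n S T =
  (∃ λ x → Facet n S x × Facet n T x)
  × MaxAffIndep (λ x → Facet n S x × Facet n T x) (n ∸ 2)

_Δ_ : ∀ {n} → Subset n → Subset n → Subset n
S Δ T = (S ─ T) ∪ (T ─ S)

-- Write A = S ∩ T and B = ∁ (S ∪ T), so that ∁ (S Δ T) = A ∪ B. Since e_Uᵀ(e_i − e_j) ≤ 1 with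
-- equality iff i ∈ U ∌ j, a point on both facets is a convex combination of edges e_a − e_b with
-- a ∈ A and b ∈ B only. Hence the intersection is nonempty iff A, B ≠ ∅, and then, for fixed
-- a ∈ A and b ∈ B, it contains the |A ∪ B| − 1 affinely independent points e_a − e_b,
-- e_t − e_b (t ∈ A ∖ a) and e_a − e_t (t ∈ B ∖ b), and no larger affinely independent family fits
-- in the flat {x : x = 0 on S Δ T, 1ᵀx = 0, e_Sᵀx = 1} containing it. So its dimension is
-- n − |S Δ T| − 2, which is n − 3 iff |S Δ T| = 1; and when |S Δ T| = 1 the labels force A, B ≠ ∅.
module Submission where

open import Defs
open import Algebra.Bundles using (Ring)
import Algebra.Properties.Semiring.Sum
open import Data.Bool as Bool using (Bool; true; false)
open import Data.Empty using (⊥-elim)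
open import Data.Fin as Fin using (Fin; zero; suc; punchIn)
open import Data.Fin.Properties using (all?; ¬∀⟶∃¬; punchInᵢ≢i; suc-injective)
open import Data.Fin.Subset using (Subset; ∣_∣; _∈_; _∉_; ∁; inside; outside) renaming (_-_ to _∖_)
open import Data.Fin.Subset.Properties
  using (_∈?_; p─⊥≡p; p─q⊆p; x∈p∧x≢y⇒x∈p-y; x∉p⇒x∈∁p; x∈∁p⇒x∉p; ∣∁p∣≡n∸∣p∣; ∣p∣≤n)
open import Data.Nat as ℕ using (ℕ; zero; suc; _≤_; _<_; _∸_; z≤n; s≤s)
import Data.Nat.Properties as ℕ
open import Data.Product using (∃; ∃₂; _×_; _,_; proj₁; proj₂; map; map₂; uncurry)
open import Data.Rational using (ℚ; 0ℚ; 1ℚ; _+_; _*_; _-_; -_; 1/_; ≢-nonZero; nonNegative)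
  renaming (_≤_ to _≤ℚ_)
import Data.Rational.Properties as ℚ
open import Data.Rational.Solver using (module +-*-Solver)
open import Data.Sum using (_⊎_; inj₁; inj₂; [_,_]′; fromInj₁; fromInj₂) renaming (map₂ to ⊎-map₂)
open import Data.Vec using (_∷_; lookup; here; there)
open import Data.Vec.Properties using ([]=⇒lookup)
open import Data.Vec.Functional using (removeAt; insertAt)
open import Data.Vec.Functional.Properties using (insertAt-lookup; insertAt-punchIn)
open import Function.Bundles using (_⇔_; mk⇔; Equivalence)
open import Relation.Nullary using (¬_; yes; no)
open import Relation.Nullary.Decidable using (decidable-stable)
open import Relation.Binary.PropositionalEquality
  using (_≡_; _≢_; refl; sym; trans; cong; cong₂; subst; subst₂; module ≡-Reasoning)

open +-*-Solver
open ≡-Reasoning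

module Σ = Algebra.Properties.Semiring.Sum (Ring.semiring ℚ.+-*-ring)

private variable
  n m k : ℕ

sumℚ≡sum : (f : Fin n → ℚ) → sumℚ f ≡ Σ.sum f
sumℚ≡sum {zero} f = refl
sumℚ≡sum {suc n} f = cong (f zero +_) (sumℚ≡sum (λ i → f (suc i)))

sumℚ-cong : {f g : Fin n → ℚ} → (∀ i → f i ≡ g i) → sumℚ f ≡ sumℚ g
sumℚ-cong {zero} f≗g = refl
sumℚ-cong {suc n} f≗g = cong₂ _+_ (f≗g zero) (sumℚ-cong (λ i → f≗g (suc i)))

sumℚ-zero : {f : Fin n → ℚ} → (∀ i → f i ≡ 0ℚ) → sumℚ f ≡ 0ℚ
sumℚ-zero {zero} f≗0 = refl
sumℚ-zero {suc n} f≗0 = cong₂ _+_ (f≗0 zero) (sumℚ-zero (λ i → f≗0 (suc i)))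

sumℚ-distrib-+ : (f g : Fin n → ℚ) → sumℚ (λ i → f i + g i) ≡ sumℚ f + sumℚ g
sumℚ-distrib-+ f g = begin
  sumℚ (λ i → f i + g i)  ≡⟨ sumℚ≡sum (λ i → f i + g i) ⟩
  Σ.sum (λ i → f i + g i) ≡⟨ Σ.∑-distrib-+ f g ⟩
  Σ.sum f + Σ.sum g       ≡⟨ cong₂ _+_ (sumℚ≡sum f) (sumℚ≡sum g) ⟨
  sumℚ f + sumℚ g         ∎

sumℚ-distrib-sub : (f g : Fin n → ℚ) → sumℚ (λ i → f i - g i) ≡ sumℚ f - sumℚ g
sumℚ-distrib-sub {zero} f g = refl
sumℚ-distrib-sub {suc n} f g =
  trans (cong (f zero - g zero +_) (sumℚ-distrib-sub (λ i → f (suc i)) (λ i → g (suc i))))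
        (solve 4 (λ a b c d → (a :- b) :+ (c :- d) := (a :+ c) :- (b :+ d)) refl
               (f zero) (g zero) (sumℚ (λ i → f (suc i))) (sumℚ (λ i → g (suc i))))

sumℚ-*ˡ : (a : ℚ) (f : Fin n → ℚ) → sumℚ (λ i → a * f i) ≡ a * sumℚ f
sumℚ-*ˡ a f = begin
  sumℚ (λ i → a * f i)  ≡⟨ sumℚ≡sum (λ i → a * f i) ⟩
  Σ.sum (λ i → a * f i) ≡⟨ Σ.*-distribˡ-sum a f ⟨
  a * Σ.sum f           ≡⟨ cong (a *_) (sumℚ≡sum f) ⟨
  a * sumℚ f            ∎

sumℚ-*ʳ : (a : ℚ) (f : Fin n → ℚ) → sumℚ (λ i → f i * a) ≡ sumℚ f * a
sumℚ-*ʳ a f = begin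
  sumℚ (λ i → f i * a)  ≡⟨ sumℚ-cong (λ i → ℚ.*-comm (f i) a) ⟩
  sumℚ (λ i → a * f i)  ≡⟨ sumℚ-*ˡ a f ⟩
  a * sumℚ f            ≡⟨ ℚ.*-comm a _ ⟩
  sumℚ f * a            ∎

sumℚ-comm : (f : Fin n → Fin m → ℚ) →
  sumℚ (λ i → sumℚ (λ j → f i j)) ≡ sumℚ (λ j → sumℚ (λ i → f i j))
sumℚ-comm f = begin
  sumℚ (λ i → sumℚ (λ j → f i j))   ≡⟨ sumℚ≡sum (λ i → sumℚ (f i)) ⟩
  Σ.sum (λ i → sumℚ (λ j → f i j))  ≡⟨ Σ.sum-cong-≗ (λ i → sumℚ≡sum (f i)) ⟩
  Σ.sum (λ i → Σ.sum (λ j → f i j)) ≡⟨ Σ.∑-comm f ⟩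
  Σ.sum (λ j → Σ.sum (λ i → f i j)) ≡⟨ Σ.sum-cong-≗ (λ j → sumℚ≡sum (λ i → f i j)) ⟨
  Σ.sum (λ j → sumℚ (λ i → f i j))  ≡⟨ sumℚ≡sum (λ j → sumℚ (λ i → f i j)) ⟨
  sumℚ (λ j → sumℚ (λ i → f i j))   ∎

sumℚ-remove : (f : Fin (suc n) → ℚ) (i : Fin (suc n)) → sumℚ f ≡ f i + sumℚ (removeAt f i)
sumℚ-remove f i = begin
  sumℚ f                     ≡⟨ sumℚ≡sum f ⟩
  Σ.sum f                    ≡⟨ Σ.sum-remove f ⟩
  f i + Σ.sum (removeAt f i) ≡⟨ cong (f i +_) (sumℚ≡sum (removeAt f i)) ⟨
  f i + sumℚ (removeAt f i)  ∎

sumℚ-single : (f : Fin n → ℚ) (i : Fin n) → (∀ j → j ≢ i → f j ≡ 0ℚ) → sumℚ f ≡ f i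
sumℚ-single {suc n} f i others≡0 = begin
  sumℚ f                    ≡⟨ sumℚ-remove f i ⟩
  f i + sumℚ (removeAt f i) ≡⟨ cong (f i +_) (sumℚ-zero (λ j → others≡0 _ (punchInᵢ≢i i j))) ⟩
  f i + 0ℚ                  ≡⟨ ℚ.+-identityʳ (f i) ⟩
  f i                       ∎

sumℚ-nonNeg : {f : Fin n → ℚ} → (∀ i → 0ℚ ≤ℚ f i) → 0ℚ ≤ℚ sumℚ f
sumℚ-nonNeg {zero} f≥0 = ℚ.≤-refl
sumℚ-nonNeg {suc n} f≥0 = ℚ.+-mono-≤ (f≥0 zero) (sumℚ-nonNeg (λ i → f≥0 (suc i)))

nonNeg⇒term≤sumℚ : {f : Fin n → ℚ} → (∀ i → 0ℚ ≤ℚ f i) → ∀ i → f i ≤ℚ sumℚ f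
nonNeg⇒term≤sumℚ {suc n} {f} f≥0 i =
  subst₂ _≤ℚ_ (ℚ.+-identityʳ (f i)) (sym (sumℚ-remove f i))
    (ℚ.+-monoʳ-≤ (f i) (sumℚ-nonNeg (λ j → f≥0 (punchIn i j))))

nonNeg-sumℚ≡0⇒≡0 : {f : Fin n → ℚ} → (∀ i → 0ℚ ≤ℚ f i) → sumℚ f ≡ 0ℚ → ∀ i → f i ≡ 0ℚ
nonNeg-sumℚ≡0⇒≡0 f≥0 Σf≡0 i = ℚ.≤-antisym (subst (_ ≤ℚ_) Σf≡0 (nonNeg⇒term≤sumℚ f≥0 i)) (f≥0 i)

sumℚ≢0⇒∃≢0 : (f : Fin n → ℚ) → sumℚ f ≢ 0ℚ → ∃ λ i → f i ≢ 0ℚ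
sumℚ≢0⇒∃≢0 {n} f Σf≢0 = ¬∀⟶∃¬ n _ (λ i → f i ℚ.≟ 0ℚ) (λ f≗0 → Σf≢0 (sumℚ-zero f≗0))

p*q≡0⇒p≡0⊎q≡0 : (p q : ℚ) → p * q ≡ 0ℚ → p ≡ 0ℚ ⊎ q ≡ 0ℚ
p*q≡0⇒p≡0⊎q≡0 p q pq≡0 with q ℚ.≟ 0ℚ
... | yes q≡0 = inj₂ q≡0
... | no q≢0 = inj₁ (begin
  p                ≡⟨ ℚ.*-identityʳ p ⟨
  p * 1ℚ           ≡⟨ cong (p *_) (ℚ.*-inverseʳ q) ⟨
  p * (q * 1/ q)   ≡⟨ ℚ.*-assoc p q (1/ q) ⟨
  (p * q) * 1/ q   ≡⟨ cong (_* 1/ q) pq≡0 ⟩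
  0ℚ * 1/ q        ≡⟨ ℚ.*-zeroˡ (1/ q) ⟩
  0ℚ               ∎)
  where instance _ = ≢-nonZero q≢0

*-nonNeg : {p q : ℚ} → 0ℚ ≤ℚ p → 0ℚ ≤ℚ q → 0ℚ ≤ℚ p * q
*-nonNeg {p} {q} p≥0 q≥0 =
  ℚ.nonNegative⁻¹ _ {{ℚ.nonNeg*nonNeg⇒nonNeg p {{nonNegative p≥0}} q {{nonNegative q≥0}}}}

infix 7 _·_
_·_ : Point n → Point n → ℚ
f · x = sumℚ (λ k → f k * x k)

·-comm : (f g : Point n) → f · g ≡ g · f
·-comm f g = sumℚ-cong (λ k → ℚ.*-comm (f k) (g k))

·-*ʳ : (f g : Point n) (a : ℚ) → f · (λ k → a * g k) ≡ a * (f · g)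
·-*ʳ f g a = trans (sumℚ-cong (λ k → solve 3 (λ f a g → f :* (a :* g) := a :* (f :* g)) refl (f k) a (g k)))
                   (sumℚ-*ˡ a (λ k → f k * g k))

·-distrib-sub : (f g h : Point n) → f · (λ k → g k - h k) ≡ f · g - f · h
·-distrib-sub f g h =
  trans (sumℚ-cong (λ k → solve 3 (λ f g h → f :* (g :- h) := f :* g :- f :* h) refl (f k) (g k) (h k)))
        (sumℚ-distrib-sub (λ k → f k * g k) (λ k → f k * h k))

·-sum : (f : Point n) (g : Fin m → Point n) → f · (λ k → sumℚ (λ j → g j k)) ≡ sumℚ (λ j → f · g j)
·-sum f g = trans (sumℚ-cong (λ k → sym (sumℚ-*ˡ (f k) (λ j → g j k))))
                  (sumℚ-comm (λ k j → f k * g j k))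

e-diag : (i : Fin n) → e i i ≡ 1ℚ
e-diag zero = refl
e-diag (suc i) = e-diag i

e-off : {i k : Fin n} → i ≢ k → e i k ≡ 0ℚ
e-off {i = zero} {zero} i≢k = ⊥-elim (i≢k refl)
e-off {i = zero} {suc k} _ = refl
e-off {i = suc i} {zero} _ = refl
e-off {i = suc i} {suc k} i≢k = e-off (λ i≡k → i≢k (cong suc i≡k))

e-nonNeg : (i k : Fin n) → 0ℚ ≤ℚ e i k
e-nonNeg i k with i Fin.≟ k
... | yes refl = subst (0ℚ ≤ℚ_) (sym (e-diag i)) (ℚ.≤ᵇ⇒≤ _)
... | no i≢k = ℚ.≤-reflexive (sym (e-off i≢k))

·-e : (f : Point n) (i : Fin n) → f · e i ≡ f i
·-e f i = begin
  f · e i     ≡⟨ sumℚ-single (λ k → f k * e i k) i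
                   (λ k k≢i → trans (cong (f k *_) (e-off (λ i≡k → k≢i (sym i≡k)))) (ℚ.*-zeroʳ (f k))) ⟩
  f i * e i i ≡⟨ cong (f i *_) (e-diag i) ⟩
  f i * 1ℚ    ≡⟨ ℚ.*-identityʳ (f i) ⟩
  f i         ∎

e-· : (i : Fin n) (f : Point n) → e i · f ≡ f i
e-· i f = trans (·-comm (e i) f) (·-e f i)

edge : Fin n → Fin n → Point n
edge i j k = e i k - e j k

edge-off : {i j t : Fin n} → i ≢ t → j ≢ t → edge i j t ≡ 0ℚ
edge-off i≢t j≢t = trans (cong₂ _-_ (e-off i≢t) (e-off j≢t)) (ℚ.+-inverseʳ 0ℚ)

·-edge : (f : Point n) (i j : Fin n) → f · edge i j ≡ f i - f j
·-edge f i j = trans (·-distrib-sub f (e i) (e j)) (cong₂ _-_ (·-e f i) (·-e f j))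

-- Linear and affine independence

linearCombination : (Fin m → ℚ) → (Fin m → Point n) → Point n
linearCombination c v t = sumℚ (λ j → c j * v j t)

·-linearCombination : (f : Point n) (c : Fin m → ℚ) (v : Fin m → Point n) →
  f · linearCombination c v ≡ sumℚ (λ j → c j * (f · v j))
·-linearCombination f c v = trans (·-sum f (λ j t → c j * v j t)) (sumℚ-cong (λ j → ·-*ʳ f (v j) (c j)))

LinearlyDependent : (Fin m → Point n) → Set
LinearlyDependent {m} v = ∃ λ (c : Fin m → ℚ) → (∃ λ j → c j ≢ 0ℚ) × (∀ t → linearCombination c v t ≡ 0ℚ)

dependent-zeroColumn : (v : Fin m → Point (suc k)) → (∀ j → v j zero ≡ 0ℚ) →
  LinearlyDependent (λ j t → v j (suc t)) → LinearlyDependent v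
dependent-zeroColumn v column≡0 (c , c≢0 , cv≡0) = c , c≢0 , λ
  { zero    → sumℚ-zero (λ j → trans (cong (c j *_) (column≡0 j)) (ℚ.*-zeroʳ (c j)))
  ; (suc t) → cv≡0 t }

eliminate : (v : Fin (suc m) → Point (suc k)) → Fin (suc m) → Fin m → Point k
eliminate v j₀ i t = v j₀ zero * v (punchIn j₀ i) (suc t) - v (punchIn j₀ i) zero * v j₀ (suc t)

dependent-pivot : (v : Fin (suc m) → Point (suc k)) (j₀ : Fin (suc m)) → v j₀ zero ≢ 0ℚ →
  LinearlyDependent (eliminate v j₀) → LinearlyDependent v
dependent-pivot v j₀ a≢0 (c′ , (i₀ , c′i₀≢0) , c′v′≡0) = c , (punchIn j₀ i₀ , ci₀≢0) , cv≡0
  where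
  a = v j₀ zero
  u : Fin _ → Point _
  u i = v (punchIn j₀ i)
  X = linearCombination c′ u zero
  c = insertAt (λ i → a * c′ i) j₀ (- X)
  split : ∀ t → linearCombination c v t ≡ - X * v j₀ t + linearCombination (λ i → a * c′ i) u t
  split t = trans (sumℚ-remove (λ j → c j * v j t) j₀)
    (cong₂ _+_ (cong (_* v j₀ t) (insertAt-lookup _ j₀ (- X)))
               (sumℚ-cong (λ i → cong (_* u i t) (insertAt-punchIn _ j₀ (- X) i))))
  ci₀≢0 : c (punchIn j₀ i₀) ≢ 0ℚ
  ci₀≢0 ci₀≡0 = [ a≢0 , c′i₀≢0 ]′
    (p*q≡0⇒p≡0⊎q≡0 a (c′ i₀) (trans (sym (insertAt-punchIn _ j₀ (- X) i₀)) ci₀≡0))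
  cv≡0 : ∀ t → linearCombination c v t ≡ 0ℚ
  cv≡0 zero = begin
    linearCombination c v zero                          ≡⟨ split zero ⟩
    - X * a + linearCombination (λ i → a * c′ i) u zero
      ≡⟨ cong (- X * a +_) (trans (sumℚ-cong (λ i → ℚ.*-assoc a (c′ i) (u i zero)))
                                  (sumℚ-*ˡ a (λ i → c′ i * u i zero))) ⟩
    - X * a + a * X
      ≡⟨ solve 2 (λ X a → :- X :* a :+ a :* X := con 0ℚ) refl X a ⟩
    0ℚ                                                  ∎
  cv≡0 (suc t) = begin
    linearCombination c v (suc t)                       ≡⟨ split (suc t) ⟩
    - X * b + linearCombination (λ i → a * c′ i) u (suc t)
      ≡⟨ cong (- X * b +_) (sumℚ-cong (λ i →
           solve 5 (λ a c w x b → (a :* c) :* w := c :* (a :* w :- x :* b) :+ (c :* x) :* b)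
                   refl a (c′ i) (u i (suc t)) (u i zero) b)) ⟩
    - X * b + sumℚ (λ i → c′ i * eliminate v j₀ i t + (c′ i * u i zero) * b)
      ≡⟨ cong (- X * b +_) (sumℚ-distrib-+ (λ i → c′ i * eliminate v j₀ i t) (λ i → (c′ i * u i zero) * b)) ⟩
    - X * b + (linearCombination c′ (eliminate v j₀) t + sumℚ (λ i → (c′ i * u i zero) * b))
      ≡⟨ cong₂ (λ y z → - X * b + (y + z)) (c′v′≡0 t) (sumℚ-*ʳ b (λ i → c′ i * u i zero)) ⟩
    - X * b + (0ℚ + X * b)
      ≡⟨ solve 2 (λ X b → :- X :* b :+ (con 0ℚ :+ X :* b) := con 0ℚ) refl X b ⟩
    0ℚ                                                  ∎
    where b = v j₀ (suc t)

linearlyDependent : k < m → (v : Fin m → Point k) → LinearlyDependent v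
linearlyDependent {zero} {suc m} _ v = (λ _ → 1ℚ) , (zero , ℚ.1≢0) , λ ()
linearlyDependent {suc k} {suc m} (s≤s k<m) v with all? (λ j → v j zero ℚ.≟ 0ℚ)
... | yes column≡0 =
  dependent-zeroColumn v column≡0 (linearlyDependent (ℕ.m<n⇒m<1+n k<m) (λ j t → v j (suc t)))
... | no column≢0 with ¬∀⟶∃¬ _ _ (λ j → v j zero ℚ.≟ 0ℚ) column≢0
...   | j₀ , a≢0 = dependent-pivot v j₀ a≢0 (linearlyDependent k<m (eliminate v j₀))

affinelyIndependent-diagonal : (p : Fin (suc k) → Point n) (ι : Fin k → Fin n) →
  (∀ i → p zero (ι i) ≡ 0ℚ) → (∀ i j → j ≢ i → p (suc j) (ι i) ≡ 0ℚ) → (∀ i → p (suc i) (ι i) ≢ 0ℚ) →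
  AffinelyIndependent p
affinelyIndependent-diagonal p ι p₀≡0 off≡0 diag≢0 c Σc≡0 cp≡0 = c≡0
  where
  c-suc≡0 : ∀ i → c (suc i) ≡ 0ℚ
  c-suc≡0 i = fromInj₁ (λ pii≡0 → ⊥-elim (diag≢0 i pii≡0))
    (p*q≡0⇒p≡0⊎q≡0 (c (suc i)) (p (suc i) (ι i))
      (trans (sym (sumℚ-single (λ j → c j * p j (ι i)) (suc i) others≡0)) (cp≡0 (ι i))))
    where
    others≡0 : ∀ j → j ≢ suc i → c j * p j (ι i) ≡ 0ℚ
    others≡0 zero    _     = trans (cong (c zero *_) (p₀≡0 i)) (ℚ.*-zeroʳ (c zero))
    others≡0 (suc j) sj≢si =
      trans (cong (c (suc j) *_) (off≡0 i j (λ j≡i → sj≢si (cong suc j≡i)))) (ℚ.*-zeroʳ (c (suc j)))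
  c≡0 : ∀ j → c j ≡ 0ℚ
  c≡0 zero = begin
    c zero                              ≡⟨ ℚ.+-identityʳ (c zero) ⟨
    c zero + 0ℚ                         ≡⟨ cong (c zero +_) (sumℚ-zero c-suc≡0) ⟨
    c zero + sumℚ (λ i → c (suc i))     ≡⟨ Σc≡0 ⟩
    0ℚ                                  ∎
  c≡0 (suc i) = c-suc≡0 i

MaxAffIndep-unique : {F : Point n → Set} {j k : ℕ} → MaxAffIndep F j → MaxAffIndep F k → j ≡ k
MaxAffIndep-unique {j = j} {k} (j-indep , j-max) (k-indep , k-max) =
  ℕ.≤-antisym (k-max j j-indep) (j-max k k-indep)

∈Δ⇒disagree : (S T : Subset n) {t : Fin n} → t ∈ S Δ T → lookup S t ≢ lookup T t
∈Δ⇒disagree (true  ∷ S) (false ∷ T) here = λ ()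
∈Δ⇒disagree (false ∷ S) (true  ∷ T) here = λ ()
∈Δ⇒disagree (_     ∷ S) (_     ∷ T) (there t∈SΔT) = ∈Δ⇒disagree S T t∈SΔT

disagree⇒∈Δ : (S T : Subset n) (t : Fin n) → lookup S t ≢ lookup T t → t ∈ S Δ T
disagree⇒∈Δ (true  ∷ S) (true  ∷ T) zero    St≢Tt = ⊥-elim (St≢Tt refl)
disagree⇒∈Δ (true  ∷ S) (false ∷ T) zero    _     = here
disagree⇒∈Δ (false ∷ S) (true  ∷ T) zero    _     = here
disagree⇒∈Δ (false ∷ S) (false ∷ T) zero    St≢Tt = ⊥-elim (St≢Tt refl)
disagree⇒∈Δ (s ∷ S) (u ∷ T) (suc t) St≢Tt = there (disagree⇒∈Δ S T t St≢Tt)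

∉Δ⇒agree : (S T : Subset n) {t : Fin n} → t ∉ S Δ T → lookup S t ≡ lookup T t
∉Δ⇒agree S T {t} t∉SΔT =
  decidable-stable (lookup S t Bool.≟ lookup T t) (λ St≢Tt → t∉SΔT (disagree⇒∈Δ S T t St≢Tt))

x∈p∖y⇒x≢y : {p : Subset n} {x y : Fin n} → x ∈ p ∖ y → x ≢ y
x∈p∖y⇒x≢y {p = _ ∷ p} {y = suc y} (there x∈p∖y) refl = x∈p∖y⇒x≢y x∈p∖y refl

∈∁⇒lookup≡false : {p : Subset n} {x : Fin n} → x ∈ ∁ p → lookup p x ≡ false
∈∁⇒lookup≡false {p = false ∷ p} here = refl
∈∁⇒lookup≡false {p = _ ∷ p} (there x∈∁p) = ∈∁⇒lookup≡false x∈∁p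

∣p∣≡1+∣p∖x∣ : {p : Subset n} {x : Fin n} → x ∈ p → ∣ p ∣ ≡ suc ∣ p ∖ x ∣
∣p∣≡1+∣p∖x∣ {p = inside ∷ p} here = cong suc (cong ∣_∣ (sym (p─⊥≡p p)))
∣p∣≡1+∣p∖x∣ {p = inside  ∷ p} (there x∈p) = cong suc (∣p∣≡1+∣p∖x∣ x∈p)
∣p∣≡1+∣p∖x∣ {p = outside ∷ p} (there x∈p) = ∣p∣≡1+∣p∖x∣ x∈p

2≤∣p∣ : {p : Subset n} {x y : Fin n} → x ∈ p → y ∈ p → x ≢ y → 2 ≤ ∣ p ∣
2≤∣p∣ x∈p y∈p x≢y = subst (2 ≤_)
  (sym (trans (∣p∣≡1+∣p∖x∣ x∈p) (cong suc (∣p∣≡1+∣p∖x∣ (x∈p∧x≢y⇒x∈p-y y∈p (λ y≡x → x≢y (sym y≡x)))))))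
  (s≤s (s≤s z≤n))

∣∁p∣+∣p∣≡n : (p : Subset n) → ∣ ∁ p ∣ ℕ.+ ∣ p ∣ ≡ n
∣∁p∣+∣p∣≡n {n} p = trans (cong (ℕ._+ ∣ p ∣) (∣∁p∣≡n∸∣p∣ p)) (ℕ.m∸n+n≡m (∣p∣≤n p))

enumerate : (p : Subset n) → Fin ∣ p ∣ → Fin n
enumerate (inside  ∷ p) zero    = zero
enumerate (inside  ∷ p) (suc i) = suc (enumerate p i)
enumerate (outside ∷ p) i       = suc (enumerate p i)

enumerate-∈ : (p : Subset n) (i : Fin ∣ p ∣) → enumerate p i ∈ p
enumerate-∈ (inside  ∷ p) zero    = here
enumerate-∈ (inside  ∷ p) (suc i) = there (enumerate-∈ p i)
enumerate-∈ (outside ∷ p) i       = there (enumerate-∈ p i)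

enumerate-injective : (p : Subset n) {i j : Fin ∣ p ∣} → enumerate p i ≡ enumerate p j → i ≡ j
enumerate-injective (inside  ∷ p) {zero}  {zero}  _  = refl
enumerate-injective (inside  ∷ p) {suc i} {suc j} eq = cong suc (enumerate-injective p (suc-injective eq))
enumerate-injective (outside ∷ p)                 eq = enumerate-injective p (suc-injective eq)

enumerate-surjective : (p : Subset n) {x : Fin n} → x ∈ p → ∃ λ i → enumerate p i ≡ x
enumerate-surjective (inside  ∷ p) here        = zero , refl
enumerate-surjective (inside  ∷ p) (there x∈p) = map (suc {n = ∣ p ∣}) (cong suc) (enumerate-surjective p x∈p)
enumerate-surjective (outside ∷ p) (there x∈p) = map₂ (cong suc) (enumerate-surjective p x∈p)

-- Points of SEP(Kₙ) and of its facets

ΣΣ : (Fin n → Fin n → ℚ) → ℚ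
ΣΣ w = sumℚ (λ i → sumℚ (λ j → w i j))

ΣΣ-cong : {v w : Fin n → Fin n → ℚ} → (∀ i j → v i j ≡ w i j) → ΣΣ v ≡ ΣΣ w
ΣΣ-cong v≗w = sumℚ-cong (λ i → sumℚ-cong (v≗w i))

·-edgeCombination : (w : Fin n → Fin n → ℚ) {x : Point n} →
  (∀ k → x k ≡ ΣΣ (λ i j → w i j * edge i j k)) →
  (f : Point n) → f · x ≡ ΣΣ (λ i j → w i j * (f i - f j))
·-edgeCombination w {x} x≡ f = begin
  f · x
    ≡⟨ sumℚ-cong (λ k → cong (f k *_) (x≡ k)) ⟩
  f · (λ k → ΣΣ (λ i j → w i j * edge i j k))
    ≡⟨ ·-sum f (λ i k → sumℚ (λ j → w i j * edge i j k)) ⟩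
  sumℚ (λ i → f · (λ k → sumℚ (λ j → w i j * edge i j k)))
    ≡⟨ sumℚ-cong (λ i → ·-sum f (λ j k → w i j * edge i j k)) ⟩
  ΣΣ (λ i j → f · (λ k → w i j * edge i j k))
    ≡⟨ ΣΣ-cong (λ i j → ·-*ʳ f (edge i j) (w i j)) ⟩
  ΣΣ (λ i j → w i j * (f · edge i j))
    ≡⟨ ΣΣ-cong (λ i j → cong (w i j *_) (·-edge f i j)) ⟩
  ΣΣ (λ i j → w i j * (f i - f j))
    ∎

SEP-sum≡0 : {x : Point n} → InSEP n x → (λ _ → 1ℚ) · x ≡ 0ℚ
SEP-sum≡0 (w , _ , _ , _ , x≡) =
  trans (·-edgeCombination w x≡ (λ _ → 1ℚ)) (sumℚ-zero (λ i → sumℚ-zero (λ j → ℚ.*-zeroʳ (w i j))))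

χ : Bool → ℚ
χ true = 1ℚ
χ false = 0ℚ

indicator≡χ : (U : Subset n) (t : Fin n) → indicator U t ≡ χ (lookup U t)
indicator≡χ U t with lookup U t
... | true = refl
... | false = refl

slack : Bool → Bool → ℚ
slack a b = 1ℚ - (χ a - χ b)

slack-nonNeg : ∀ a b → 0ℚ ≤ℚ slack a b
slack-nonNeg true true = ℚ.≤ᵇ⇒≤ _
slack-nonNeg true false = ℚ.≤-refl
slack-nonNeg false true = ℚ.≤ᵇ⇒≤ _
slack-nonNeg false false = ℚ.≤ᵇ⇒≤ _

slack≡0⇒ : ∀ a b → slack a b ≡ 0ℚ → a ≡ true × b ≡ false
slack≡0⇒ true  false _ = refl , refl
slack≡0⇒ true  true  ()
slack≡0⇒ false true  ()
slack≡0⇒ false false ()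

-- 1 − e_Uᵀx = Σ w_ij (1 − e_Uᵀ(e_i − e_j)) is a sum of nonnegative terms, so each vanishes.
facet-support : {x : Point n} (U : Subset n) (x∈ : InSEP n x) → dotS U x ≡ 1ℚ →
  ∀ i j → proj₁ x∈ i j ≡ 0ℚ ⊎ (lookup U i ≡ true × lookup U j ≡ false)
facet-support {x = x} U (w , w≥0 , _ , Σw≡1 , x≡) Ux≡1 i j
  = ⊎-map₂ (slack≡0⇒ (u i) (u j)) (p*q≡0⇒p≡0⊎q≡0 (w i j) (slack (u i) (u j)) gij≡0)
  where
  u = lookup U
  g : Fin _ → Fin _ → ℚ
  g i j = w i j * slack (u i) (u j)
  g≥0 : ∀ i j → 0ℚ ≤ℚ g i j
  g≥0 i j = *-nonNeg (w≥0 i j) (slack-nonNeg (u i) (u j))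
  Σg≡0 : ΣΣ g ≡ 0ℚ
  Σg≡0 = begin
    ΣΣ g
      ≡⟨ ΣΣ-cong (λ i j → solve 2 (λ w d → w :* (con 1ℚ :- d) := w :- w :* d) refl
                                   (w i j) (χ (u i) - χ (u j))) ⟩
    ΣΣ (λ i j → w i j - w i j * (χ (u i) - χ (u j)))
      ≡⟨ trans (sumℚ-cong (λ i → sumℚ-distrib-sub (w i) _)) (sumℚ-distrib-sub (λ i → sumℚ (w i)) _) ⟩
    ΣΣ w - ΣΣ (λ i j → w i j * (χ (u i) - χ (u j)))
      ≡⟨ cong (λ z → ΣΣ w - z) (·-edgeCombination w x≡ (λ k → χ (u k))) ⟨
    ΣΣ w - (λ k → χ (u k)) · x
      ≡⟨ cong₂ _-_ Σw≡1 (trans (sumℚ-cong (λ k → cong (_* x k) (sym (indicator≡χ U k)))) Ux≡1) ⟩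
    1ℚ - 1ℚ
      ≡⟨⟩
    0ℚ
      ∎
  gij≡0 : g i j ≡ 0ℚ
  gij≡0 = nonNeg-sumℚ≡0⇒≡0 (g≥0 i) (nonNeg-sumℚ≡0⇒≡0 (λ i → sumℚ-nonNeg (g≥0 i)) Σg≡0 i) j

edge∈SEP : {i j : Fin n} → i ≢ j → InSEP n (edge i j)
edge∈SEP {n} {i} {j} i≢j = w , w≥0 , w-diag , Σw≡1 , (λ k → sym (ΣΣ-w* (λ i' j' → edge i' j' k)))
  where
  w : Fin n → Fin n → ℚ
  w i' j' = e i i' * e j j'
  ΣΣ-w* : (g : Fin n → Fin n → ℚ) → ΣΣ (λ i' j' → w i' j' * g i' j') ≡ g i j
  ΣΣ-w* g = begin
    ΣΣ (λ i' j' → w i' j' * g i' j')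
      ≡⟨ ΣΣ-cong (λ i' j' → ℚ.*-assoc (e i i') (e j j') (g i' j')) ⟩
    sumℚ (λ i' → sumℚ (λ j' → e i i' * (e j j' * g i' j')))
      ≡⟨ sumℚ-cong (λ i' → sumℚ-*ˡ (e i i') (λ j' → e j j' * g i' j')) ⟩
    e i · (λ i' → e j · g i')
      ≡⟨ sumℚ-cong (λ i' → cong (e i i' *_) (e-· j (g i'))) ⟩
    e i · (λ i' → g i' j)
      ≡⟨ e-· i (λ i' → g i' j) ⟩
    g i j
      ∎
  w≥0 : ∀ i' j' → 0ℚ ≤ℚ w i' j'
  w≥0 i' j' = *-nonNeg (e-nonNeg i i') (e-nonNeg j j')
  w-diag : ∀ i' → w i' i' ≡ 0ℚ
  w-diag i' with i Fin.≟ i'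
  ... | yes refl = trans (cong (e i i *_) (e-off (λ j≡i → i≢j (sym j≡i)))) (ℚ.*-zeroʳ (e i i))
  ... | no i≢i' = trans (cong (_* e j i') (e-off i≢i')) (ℚ.*-zeroˡ (e j i'))
  Σw≡1 : ΣΣ w ≡ 1ℚ
  Σw≡1 = trans (ΣΣ-cong (λ i' j' → sym (ℚ.*-identityʳ (w i' j')))) (ΣΣ-w* (λ _ _ → 1ℚ))

edge∈Facet : (U : Subset n) {i j : Fin n} → lookup U i ≡ true → lookup U j ≡ false → Facet n U (edge i j)
edge∈Facet U {i} {j} Ui≡true Uj≡false = edge∈SEP i≢j , (begin
  indicator U · edge i j          ≡⟨ ·-edge (indicator U) i j ⟩
  indicator U i - indicator U j   ≡⟨ cong₂ _-_ (indicator≡χ U i) (indicator≡χ U j) ⟩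
  χ (lookup U i) - χ (lookup U j) ≡⟨ cong₂ (λ a b → χ a - χ b) Ui≡true Uj≡false ⟩
  1ℚ                              ∎)
  where
  i≢j : i ≢ j
  i≢j refl with trans (sym Ui≡true) Uj≡false
  ... | ()

-- Affinely independent families in a flat

record Flat (D U : Subset n) (x : Point n) : Set where
  field
    zero-on : ∀ {t} → t ∈ D → x t ≡ 0ℚ
    sum≡0   : (λ _ → 1ℚ) · x ≡ 0ℚ
    dot≡1   : dotS U x ≡ 1ℚ

open Flat

-- A combination vanishing on ∁ D ∖ b vanishes on D by flatness and at b because 1ᵀx = 0; as b ∉ U,
-- e_Uᵀx = 1 then forces Σ c = 0, so linear dependence on those coordinates is affine dependence.
flat-combination≡0 : {D U : Subset n} {b : Fin n} → lookup U b ≡ false →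
  (p : Fin m → Point n) → (∀ j → Flat D U (p j)) → (c : Fin m → ℚ) →
  (∀ {t} → t ∈ ∁ D ∖ b → linearCombination c p t ≡ 0ℚ) →
  sumℚ c ≡ 0ℚ × (∀ t → linearCombination c p t ≡ 0ℚ)
flat-combination≡0 {D = D} {U} {b} Ub≡false p p∈ c vanishes = Σc≡0 , G≡0
  where
  G = linearCombination c p
  G-off-b : ∀ t → t ≢ b → G t ≡ 0ℚ
  G-off-b t t≢b with t ∈? D
  ... | yes t∈D = sumℚ-zero (λ j → trans (cong (c j *_) (zero-on (p∈ j) t∈D)) (ℚ.*-zeroʳ (c j)))
  ... | no t∉D = vanishes (x∈p∧x≢y⇒x∈p-y (x∉p⇒x∈∁p t∉D) t≢b)
  Σc≡0 : sumℚ c ≡ 0ℚ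
  Σc≡0 = begin
    sumℚ c                          ≡⟨ sumℚ-cong (λ j → ℚ.*-identityʳ (c j)) ⟨
    sumℚ (λ j → c j * 1ℚ)           ≡⟨ sumℚ-cong (λ j → cong (c j *_) (dot≡1 (p∈ j))) ⟨
    sumℚ (λ j → c j * dotS U (p j)) ≡⟨ ·-linearCombination (indicator U) c p ⟨
    indicator U · G                 ≡⟨ sumℚ-zero U·G-term≡0 ⟩
    0ℚ                              ∎
    where
    U·G-term≡0 : ∀ t → indicator U t * G t ≡ 0ℚ
    U·G-term≡0 t with t Fin.≟ b
    ... | yes refl = trans (cong (_* G b) (trans (indicator≡χ U b) (cong χ Ub≡false))) (ℚ.*-zeroˡ (G b))
    ... | no t≢b = trans (cong (indicator U t *_) (G-off-b t t≢b)) (ℚ.*-zeroʳ (indicator U t))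
  Gb≡0 : G b ≡ 0ℚ
  Gb≡0 = begin
    G b                                   ≡⟨ ℚ.*-identityˡ (G b) ⟨
    1ℚ * G b                              ≡⟨ sumℚ-single (λ t → 1ℚ * G t) b 1G-off-b ⟨
    (λ _ → 1ℚ) · G                        ≡⟨ ·-linearCombination (λ _ → 1ℚ) c p ⟩
    sumℚ (λ j → c j * ((λ _ → 1ℚ) · p j)) ≡⟨ sumℚ-zero (λ j → trans (cong (c j *_) (sum≡0 (p∈ j))) (ℚ.*-zeroʳ (c j))) ⟩
    0ℚ                                    ∎
    where
    1G-off-b : ∀ t → t ≢ b → 1ℚ * G t ≡ 0ℚ
    1G-off-b t t≢b = trans (cong (1ℚ *_) (G-off-b t t≢b)) (ℚ.*-zeroʳ 1ℚ)
  G≡0 : ∀ t → G t ≡ 0ℚ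
  G≡0 t with t Fin.≟ b
  ... | yes refl = Gb≡0
  ... | no t≢b = G-off-b t t≢b

flat-affIndep-≤ : {D U : Subset n} {b : Fin n} → lookup U b ≡ false →
  (p : Fin m → Point n) → (∀ j → Flat D U (p j)) → AffinelyIndependent p → m ≤ ∣ ∁ D ∖ b ∣
flat-affIndep-≤ {m = m} {D = D} {U} {b} Ub≡false p p∈ p-indep with m ℕ.≤? ∣ ∁ D ∖ b ∣
... | yes m≤ = m≤
... | no m≰ with linearlyDependent (ℕ.≰⇒> m≰) (λ j i → p j (enumerate (∁ D ∖ b) i))
...   | c , (j , cj≢0) , cp∘enumerate≡0 =
  ⊥-elim (cj≢0 (uncurry (p-indep c) (flat-combination≡0 {U = U} Ub≡false p p∈ c vanishes) j))
  where
  vanishes : ∀ {t} → t ∈ ∁ D ∖ b → linearCombination c p t ≡ 0ℚ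
  vanishes t∈ with enumerate-surjective (∁ D ∖ b) t∈
  ... | i , refl = cp∘enumerate≡0 i

-- Intersection of two facets

module FacetPair {n : ℕ} (S T : Subset n) where

  F∩ : Point n → Set
  F∩ x = Facet n S x × Facet n T x

  Agree : Bool → Fin n → Set
  Agree β t = lookup S t ≡ β × lookup T t ≡ β

  Agree⇒∉Δ : {β : Bool} {t : Fin n} → Agree β t → t ∉ S Δ T
  Agree⇒∉Δ (St≡β , Tt≡β) t∈Δ = ∈Δ⇒disagree S T t∈Δ (trans St≡β (sym Tt≡β))

  support∩ : {x : Point n} (x∈ : InSEP n x) → dotS S x ≡ 1ℚ → dotS T x ≡ 1ℚ →
    ∀ i j → proj₁ x∈ i j ≡ 0ℚ ⊎ (Agree true i × Agree false j)
  support∩ x∈ Sx≡1 Tx≡1 i j = merge (facet-support S x∈ Sx≡1 i j) (facet-support T x∈ Tx≡1 i j)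
    where
    merge : {Z : Set} → Z ⊎ (lookup S i ≡ true × lookup S j ≡ false) →
      Z ⊎ (lookup T i ≡ true × lookup T j ≡ false) → Z ⊎ (Agree true i × Agree false j)
    merge (inj₁ z)             _                  = inj₁ z
    merge (inj₂ _)             (inj₁ z)           = inj₁ z
    merge (inj₂ (Si , Sj))     (inj₂ (Ti , Tj))   = inj₂ ((Si , Ti) , (Sj , Tj))

  F∩-vanishes-on-Δ : {x : Point n} → F∩ x → ∀ {t} → t ∈ S Δ T → x t ≡ 0ℚ
  F∩-vanishes-on-Δ ((x∈@(w , _ , _ , _ , x≡) , Sx≡1) , (_ , Tx≡1)) {t} t∈Δ =
    trans (x≡ t) (sumℚ-zero (λ i → sumℚ-zero (λ j → term≡0 i j)))
    where
    term≡0 : ∀ i j → w i j * edge i j t ≡ 0ℚ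
    term≡0 i j = [ (λ wij≡0 → trans (cong (_* edge i j t) wij≡0) (ℚ.*-zeroˡ (edge i j t)))
                 , (λ (i∈A , j∈B) → trans (cong (w i j *_) (edge-off (≢t i∈A) (≢t j∈B))) (ℚ.*-zeroʳ (w i j)))
                 ]′ (support∩ x∈ Sx≡1 Tx≡1 i j)
      where
      ≢t : {β : Bool} {s : Fin n} → Agree β s → s ≢ t
      ≢t s∈ refl = Agree⇒∉Δ s∈ t∈Δ

  F∩⊆Flat : {x : Point n} → F∩ x → Flat (S Δ T) S x
  F∩⊆Flat x∈F∩@((x∈ , Sx≡1) , _) =
    record { zero-on = F∩-vanishes-on-Δ x∈F∩ ; sum≡0 = SEP-sum≡0 x∈ ; dot≡1 = Sx≡1 }

  F∩-supportingEdge : {x : Point n} → F∩ x → ∃₂ λ a b → Agree true a × Agree false b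
  F∩-supportingEdge ((x∈@(w , _ , _ , Σw≡1 , _) , Sx≡1) , (_ , Tx≡1)) =
    let (i , Σwi≢0) = sumℚ≢0⇒∃≢0 (λ i → sumℚ (w i)) (λ Σw≡0 → ℚ.1≢0 (trans (sym Σw≡1) Σw≡0))
        (j , wij≢0) = sumℚ≢0⇒∃≢0 (w i) Σwi≢0
    in i , j , fromInj₂ (λ wij≡0 → ⊥-elim (wij≢0 wij≡0)) (support∩ x∈ Sx≡1 Tx≡1 i j)

  edge∈F∩ : {i j : Fin n} → Agree true i → Agree false j → F∩ (edge i j)
  edge∈F∩ (Si , Ti) (Sj , Tj) = edge∈Facet S Si Sj , edge∈Facet T Ti Tj

  ∣Δ∣≡1⇒agree : {β : Bool} {s t : Fin n} → ∣ S Δ T ∣ ≡ 1 → lookup S s ≡ β → lookup T t ≡ β → ∃ (Agree β)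
  ∣Δ∣≡1⇒agree {β} {s} {t} ∣Δ∣≡1 Ss≡β Tt≡β with lookup T s Bool.≟ β | lookup S t Bool.≟ β
  ... | yes Ts≡β | _        = s , Ss≡β , Ts≡β
  ... | no _     | yes St≡β = t , St≡β , Tt≡β
  ... | no Ts≢β  | no St≢β  = ⊥-elim (2≰1 (subst (2 ≤_) ∣Δ∣≡1 (2≤∣p∣ s∈Δ t∈Δ s≢t)))
    where
    s∈Δ : s ∈ S Δ T
    s∈Δ = disagree⇒∈Δ S T s (λ Ss≡Ts → Ts≢β (trans (sym Ss≡Ts) Ss≡β))
    t∈Δ : t ∈ S Δ T
    t∈Δ = disagree⇒∈Δ S T t (λ St≡Tt → St≢β (trans St≡Tt Tt≡β))
    s≢t : s ≢ t
    s≢t refl = St≢β Ss≡β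
    2≰1 : ¬ (2 ≤ 1)
    2≰1 (s≤s ())

  module Dimension {a b : Fin n} (a∈A : Agree true a) (b∈B : Agree false b) where

    M : Subset n
    M = ∁ (S Δ T) ∖ b

    edgeFrom : Bool → Fin n → Point n
    edgeFrom true  t = edge t b
    edgeFrom false t = edge a t

    edgeFrom∈F∩ : {β : Bool} {t : Fin n} → Agree β t → F∩ (edgeFrom β t)
    edgeFrom∈F∩ {true}  t∈A = edge∈F∩ t∈A b∈B
    edgeFrom∈F∩ {false} t∈B = edge∈F∩ a∈A t∈B

    module _ {t : Fin n} (t≢a : t ≢ a) (t≢b : t ≢ b) where
      a≢t = λ a≡t → t≢a (sym a≡t)
      b≢t = λ b≡t → t≢b (sym b≡t)

      edge-ab≡0 : edge a b t ≡ 0ℚ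
      edge-ab≡0 = edge-off a≢t b≢t

      edgeFrom-off≡0 : (β : Bool) {t′ : Fin n} → t′ ≢ t → edgeFrom β t′ t ≡ 0ℚ
      edgeFrom-off≡0 true  t′≢t = edge-off t′≢t b≢t
      edgeFrom-off≡0 false t′≢t = edge-off a≢t t′≢t

      edgeFrom-diag≢0 : (β : Bool) → edgeFrom β t t ≢ 0ℚ
      edgeFrom-diag≢0 true  eq = 1-0≢0 (trans (sym (cong₂ _-_ (e-diag t) (e-off b≢t))) eq)
        where 1-0≢0 : 1ℚ - 0ℚ ≢ 0ℚ
              1-0≢0 ()
      edgeFrom-diag≢0 false eq = 0-1≢0 (trans (sym (cong₂ _-_ (e-off a≢t) (e-diag t))) eq)
        where 0-1≢0 : 0ℚ - 1ℚ ≢ 0ℚ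
              0-1≢0 ()

    a≢b : a ≢ b
    a≢b refl with trans (sym (proj₁ a∈A)) (proj₁ b∈B)
    ... | ()

    a∈M : a ∈ M
    a∈M = x∈p∧x≢y⇒x∈p-y (x∉p⇒x∈∁p (Agree⇒∉Δ a∈A)) a≢b

    b∈∁Δ : b ∈ ∁ (S Δ T)
    b∈∁Δ = x∉p⇒x∈∁p (Agree⇒∉Δ b∈B)

    ∈M∖a⇒ : {t : Fin n} → t ∈ M ∖ a → Agree (lookup S t) t × t ≢ a × t ≢ b
    ∈M∖a⇒ t∈M∖a = (refl , sym (∉Δ⇒agree S T (x∈∁p⇒x∉p (p─q⊆p _ _ t∈M)))) , x∈p∖y⇒x≢y t∈M∖a , x∈p∖y⇒x≢y t∈M
      where t∈M = p─q⊆p _ _ t∈M∖a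

    ι : Fin ∣ M ∖ a ∣ → Fin n
    ι = enumerate (M ∖ a)

    ι≢a : ∀ i → ι i ≢ a
    ι≢a i = proj₁ (proj₂ (∈M∖a⇒ (enumerate-∈ (M ∖ a) i)))

    ι≢b : ∀ i → ι i ≢ b
    ι≢b i = proj₂ (proj₂ (∈M∖a⇒ (enumerate-∈ (M ∖ a) i)))

    family : Fin (suc ∣ M ∖ a ∣) → Point n
    family zero    = edge a b
    family (suc i) = edgeFrom (lookup S (ι i)) (ι i)

    family∈F∩ : ∀ j → F∩ (family j)
    family∈F∩ zero    = edge∈F∩ a∈A b∈B
    family∈F∩ (suc i) = edgeFrom∈F∩ (proj₁ (∈M∖a⇒ (enumerate-∈ (M ∖ a) i)))

    family-affIndep : AffinelyIndependent family
    family-affIndep = affinelyIndependent-diagonal family ι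
      (λ i → edge-ab≡0 (ι≢a i) (ι≢b i))
      (λ i j j≢i → edgeFrom-off≡0 (ι≢a i) (ι≢b i) (lookup S (ι j))
                     (λ ιj≡ιi → j≢i (enumerate-injective (M ∖ a) ιj≡ιi)))
      (λ i → edgeFrom-diag≢0 (ι≢a i) (ι≢b i) (lookup S (ι i)))

    F∩-max : MaxAffIndep F∩ ∣ M ∣
    F∩-max = subst (HasAffIndep F∩) (sym (∣p∣≡1+∣p∖x∣ a∈M)) (family , family∈F∩ , family-affIndep)
           , λ m (p , p∈F∩ , p-indep) →
               flat-affIndep-≤ {U = S} (proj₁ b∈B) p (λ j → F∩⊆Flat (p∈F∩ j)) p-indep

    n∸2≡ : n ∸ 2 ≡ ∣ M ∖ a ∣ ℕ.+ ∣ S Δ T ∣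
    n∸2≡ = cong (_∸ 2) (trans (sym (∣∁p∣+∣p∣≡n (S Δ T)))
             (cong (ℕ._+ ∣ S Δ T ∣) (trans (∣p∣≡1+∣p∖x∣ b∈∁Δ) (cong suc (∣p∣≡1+∣p∖x∣ a∈M)))))

    MaxAffIndep⇔∣Δ∣≡1 : MaxAffIndep F∩ (n ∸ 2) ⇔ ∣ S Δ T ∣ ≡ 1
    MaxAffIndep⇔∣Δ∣≡1 = mk⇔
      (λ max → ℕ.+-cancelˡ-≡ K _ _
                 (trans (sym n∸2≡) (trans (MaxAffIndep-unique {F = F∩} max F∩-max) ∣M∣≡K+1)))
      (λ ∣Δ∣≡1 → subst (MaxAffIndep F∩) (sym (trans n∸2≡ (trans (cong (K ℕ.+_) ∣Δ∣≡1) (sym ∣M∣≡K+1)))) F∩-max)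
      where
      K = ∣ M ∖ a ∣
      ∣M∣≡K+1 : ∣ M ∣ ≡ K ℕ.+ 1
      ∣M∣≡K+1 = trans (∣p∣≡1+∣p∖x∣ a∈M) (ℕ.+-comm 1 K)

lemma3p4 : (n : ℕ) (S T : Subset n) → IsLabel S → IsLabel T →
    Adjacent n S T ⇔ (∣ S Δ T ∣ ≡ 1)
lemma3p4 n S T ((s , s∈S) , (s′ , s′∈∁S)) ((t , t∈T) , (t′ , t′∈∁T)) = mk⇔ to from
  where
  open FacetPair S T
  to : Adjacent n S T → ∣ S Δ T ∣ ≡ 1
  to ((x , x∈F∩) , max) =
    let a , b , a∈A , b∈B = F∩-supportingEdge x∈F∩
    in Equivalence.to (Dimension.MaxAffIndep⇔∣Δ∣≡1 a∈A b∈B) max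
  from : ∣ S Δ T ∣ ≡ 1 → Adjacent n S T
  from ∣Δ∣≡1 =
    let a , a∈A = ∣Δ∣≡1⇒agree ∣Δ∣≡1 ([]=⇒lookup s∈S) ([]=⇒lookup t∈T)
        b , b∈B = ∣Δ∣≡1⇒agree ∣Δ∣≡1 (∈∁⇒lookup≡false s′∈∁S) (∈∁⇒lookup≡false t′∈∁T)
    in (edge a b , edge∈F∩ a∈A b∈B) , Equivalence.from (Dimension.MaxAffIndep⇔∣Δ∣≡1 a∈A b∈B) ∣Δ∣≡1
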